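{- $$\sum_{u\in V}\sum_{v\in N_u^+}f_{uv}\le 34\cdot\mathsf{OPT}(1).$$
   Context: $G=(V,E)$ is a complete graph with every edge labeled positive or negative; every vertex has a positive self-loop. $N_u^+$ ($N_u^-$) is the set of $v$ with $(u,v)$ positive (negative), and $\Delta_u=|N_u^+|$. The correlation metric is $d_{uv}=1-\frac{|N_u^+\cap N_v^+|}{|N_u^+\cup N_v^+|}$. The adjusted correlation metric $f$: (1) set $f=d$; (2) for every negative edge $(u,v)$ with $d_{uv}>0.7$ set $f_{uv}=1$; (3) for every $u$ with $|N_u^-\cap\{v: d_{uv}\le 0.7\}|\ge\frac{10}{3}\Delta_u$, set $f_{uv}=1$ for all $v\ne u$. A clustering is a partition of $V$; a positive edge is a disagreement if its endpoints are in different clusters, a negative edge if in the same cluster; $y_{\mathcal{C}}(u)$ counts disagreements at $u$; $\mathsf{OPT}(1)=\min_{\mathcal{C}}\sum_u y_{\mathcal{C}}(u)$. -}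

module Defs where

open import Data.Bool using (Bool; true; false; if_then_else_; _∧_; _∨_; not)
open import Data.Nat as ℕ using (ℕ; zero; suc)
open import Data.Integer using (+_)
open import Data.Fin using (Fin; _≟_)
open import Data.List using (List; foldr; map; allFin)
open import Data.Rational using (ℚ; _/_; 0ℚ; 1ℚ; _-_; _+_; _*_; _≤_)
open import Data.Rational.Properties using (_≤?_; _<?_)
open import Relation.Nullary.Decidable using (⌊_⌋)

-- A complete signed graph on V = Fin n: sign u v = true means (u,v) is
-- positive, false means negative.  (Symmetry and positive self-loops are
-- hypotheses of the theorem.)
SignedGraph : ℕ → Set
SignedGraph n = Fin n → Fin n → Bool

count : ∀ {n} → (Fin n → Bool) → ℕ
count {n} P = foldr (λ v acc → if P v then suc acc else acc) 0 (allFin n)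

sumℚ : ∀ {n} → (Fin n → Bool) → (Fin n → ℚ) → ℚ
sumℚ {n} P g = foldr (λ v acc → if P v then g v + acc else acc) 0ℚ (allFin n)

-- natural number as a rational, and a / b for naturals (b = 0 never occurs
-- below since the union contains u by the positive self-loop)
ℕ→ℚ : ℕ → ℚ
ℕ→ℚ k = + k / 1

divℕ : ℕ → ℕ → ℚ
divℕ a zero    = 0ℚ
divℕ a (suc b) = + a / suc b

module _ {n : ℕ} (G : SignedGraph n) where

  Δ : Fin n → ℕ
  Δ u = count (λ v → G u v)

  d : Fin n → Fin n → ℚ
  d u v = 1ℚ - divℕ (count (λ w → G u w ∧ G v w)) (count (λ w → G u w ∨ G v w))

  seven-tenths : ℚ
  seven-tenths = + 7 / 10

  bad : Fin n → Bool
  bad u = ⌊ ((+ 10 / 3) * ℕ→ℚ (Δ u)) ≤?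
              ℕ→ℚ (count (λ v → not (G u v) ∧ ⌊ d u v ≤? seven-tenths ⌋)) ⌋

  -- adjusted correlation metric f (step (3) applied last, symmetrically)
  f : Fin n → Fin n → ℚ
  f u v =
    if not ⌊ u ≟ v ⌋ ∧ (bad u ∨ bad v) then 1ℚ
    else (if not (G u v) ∧ ⌊ seven-tenths <? d u v ⌋ then 1ℚ else d u v)

  -- clusterings: a labelling c : V → Fin n (every partition of V arises so)
  Clustering : Set
  Clustering = Fin n → Fin n

  sameCluster : Clustering → Fin n → Fin n → Bool
  sameCluster c u v = ⌊ c u ≟ c v ⌋

  y : Clustering → Fin n → ℕ
  y c u = count (λ v → (G u v ∧ not (sameCluster c u v))
                     ∨ (not (G u v) ∧ sameCluster c u v))

  cost : Clustering → ℕ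
  cost c = foldr (λ u acc → y c u ℕ.+ acc) 0 (allFin n)

  fPositiveSum : ℚ
  fPositiveSum = foldr (λ u acc → sumℚ (λ v → G u v) (λ v → f u v) + acc) 0ℚ (allFin n)

-- A positive edge uv with f_uv = 1 because of step (3) is paid for by a bad endpoint; otherwise
-- f_uv = d_uv, which is at most y_u/Δ_u + y_v/Δ_v when u and v share a cluster (every vertex of
-- N_u^+ ∪ N_v^+ outside N_u^+ ∩ N_v^+ is a disagreement at u or at v) and at most 1 = [uv is a
-- disagreement] otherwise.  Hence Σ f ≤ 2 Σ_u Δ_u ([u bad] + y_u/Δ_u) + cost.  A bad u with
-- Δ_u ≤ 8 y_u pays for itself.  If 8 y_u < Δ_u, at least (77/24) Δ_u of its close negative
-- neighbours v lie outside u's cluster, and each shares at least (7/40) Δ_u positive neighbours w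
-- with u inside u's cluster.  Each such witness triple (u, v, w) makes vw a disagreement at v,
-- and counting them gives Δ_u² ≤ 2 Z_u.  A disagreement vw is witnessed only by vertices u of
-- w's cluster, which has at most (9/8) Δ_u elements, so Σ_u Z_u/Δ_u ≤ (9/8) cost; altogether
-- Σ f ≤ 23.5 cost.

module Submission where

open import Data.Integer as ℤ using (+_)
import Data.Integer.Properties as ℤP
open import Data.Integer.Tactic.RingSolver as ℤSolver using ()
open import Data.Bool using (Bool; true; false; if_then_else_; _∧_; _∨_; not)
open import Data.Bool.Properties using (∧-conicalˡ; ∧-conicalʳ; ∨-zeroʳ)
open import Data.Fin using (Fin; _≟_)
open import Data.List using (List; []; _∷_; foldr; allFin)
open import Data.List.Membership.Propositional.Properties using (∈-allFin)
open import Data.List.Membership.Propositional using (_∈_)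
open import Data.List.Relation.Unary.Any using (here; there)
open import Data.Nat as ℕ using (ℕ; zero; suc; z≤n; s≤s)
import Data.Nat.Properties as ℕP
open import Data.Nat.Tactic.RingSolver using (solve-∀)
open import Data.Rational as ℚ using (ℚ; _/_; _+_; _-_; _*_; _≤_; 0ℚ; 1ℚ)
import Data.Rational.Properties as ℚP
open import Data.Rational.Solver using (module +-*-Solver)
open import Data.Rational.Unnormalised as ℚᵘ using (mkℚᵘ; *≡*; *≤*)
import Data.Rational.Unnormalised.Properties as ℚᵘP
open import Data.Product using (_×_; _,_)
open import Data.Sum using (_⊎_; inj₁; inj₂; [_,_]′)
open import Relation.Binary.PropositionalEquality
open import Relation.Nullary using (Dec; yes; no; ¬_; contradiction)
open import Relation.Nullary.Decidable using (⌊_⌋)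
open import Defs

open +-*-Solver using (solve; _:*_; _:=_)

toℚᵘ-ℕ→ℚ : ∀ k → ℚ.toℚᵘ (ℕ→ℚ k) ℚᵘ.≃ mkℚᵘ (+ k) 0
toℚᵘ-ℕ→ℚ k = ℚP.toℚᵘ-fromℚᵘ (mkℚᵘ (+ k) 0)

ℕ→ℚ-+ : ∀ a b → ℕ→ℚ (a ℕ.+ b) ≡ ℕ→ℚ a + ℕ→ℚ b
ℕ→ℚ-+ a b = ℚP.toℚᵘ-injective (begin
  ℚ.toℚᵘ (ℕ→ℚ (a ℕ.+ b))                   ≈⟨ toℚᵘ-ℕ→ℚ (a ℕ.+ b) ⟩
  mkℚᵘ (+ (a ℕ.+ b)) 0                     ≈⟨ *≡* (trans (cong (ℤ._* + 1) (ℤP.pos-+ a b)) (ones (+ a) (+ b))) ⟩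
  mkℚᵘ (+ a) 0 ℚᵘ.+ mkℚᵘ (+ b) 0           ≈⟨ ℚᵘP.+-cong (ℚᵘP.≃-sym (toℚᵘ-ℕ→ℚ a)) (ℚᵘP.≃-sym (toℚᵘ-ℕ→ℚ b)) ⟩
  ℚ.toℚᵘ (ℕ→ℚ a) ℚᵘ.+ ℚ.toℚᵘ (ℕ→ℚ b)       ≈⟨ ℚᵘP.≃-sym (ℚP.toℚᵘ-homo-+ (ℕ→ℚ a) (ℕ→ℚ b)) ⟩
  ℚ.toℚᵘ (ℕ→ℚ a + ℕ→ℚ b)                   ∎)
  where
  open ℚᵘP.≃-Reasoning
  ones : ∀ x y → (x ℤ.+ y) ℤ.* + 1 ≡ (x ℤ.* + 1 ℤ.+ y ℤ.* + 1) ℤ.* + 1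
  ones = ℤSolver.solve-∀

ℕ→ℚ-* : ∀ a b → ℕ→ℚ (a ℕ.* b) ≡ ℕ→ℚ a * ℕ→ℚ b
ℕ→ℚ-* a b = ℚP.toℚᵘ-injective (begin
  ℚ.toℚᵘ (ℕ→ℚ (a ℕ.* b))                   ≈⟨ toℚᵘ-ℕ→ℚ (a ℕ.* b) ⟩
  mkℚᵘ (+ (a ℕ.* b)) 0                     ≈⟨ *≡* (cong (ℤ._* + 1) (ℤP.pos-* a b)) ⟩
  mkℚᵘ (+ a) 0 ℚᵘ.* mkℚᵘ (+ b) 0           ≈⟨ ℚᵘP.*-cong (ℚᵘP.≃-sym (toℚᵘ-ℕ→ℚ a)) (ℚᵘP.≃-sym (toℚᵘ-ℕ→ℚ b)) ⟩
  ℚ.toℚᵘ (ℕ→ℚ a) ℚᵘ.* ℚ.toℚᵘ (ℕ→ℚ b)       ≈⟨ ℚᵘP.≃-sym (ℚP.toℚᵘ-homo-* (ℕ→ℚ a) (ℕ→ℚ b)) ⟩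
  ℚ.toℚᵘ (ℕ→ℚ a * ℕ→ℚ b)                   ∎)
  where open ℚᵘP.≃-Reasoning

ℕ→ℚ-mono-≤ : ∀ {a b} → a ℕ.≤ b → ℕ→ℚ a ≤ ℕ→ℚ b
ℕ→ℚ-mono-≤ {a} {b} a≤b = ℚP.toℚᵘ-cancel-≤
  (ℚᵘP.≤-respˡ-≃ (ℚᵘP.≃-sym (toℚᵘ-ℕ→ℚ a)) (ℚᵘP.≤-respʳ-≃ (ℚᵘP.≃-sym (toℚᵘ-ℕ→ℚ b))
    (*≤* (ℤP.*-monoʳ-≤-nonNeg (+ 1) (ℤ.+≤+ a≤b)))))

ℕ→ℚ-cancel-≤ : ∀ {a b} → ℕ→ℚ a ≤ ℕ→ℚ b → a ℕ.≤ b
ℕ→ℚ-cancel-≤ {a} {b} le with ℚᵘP.≤-respˡ-≃ (toℚᵘ-ℕ→ℚ a) (ℚᵘP.≤-respʳ-≃ (toℚᵘ-ℕ→ℚ b) (ℚP.toℚᵘ-mono-≤ le))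
... | *≤* p with subst₂ ℤ._≤_ (ℤP.*-identityʳ (+ a)) (ℤP.*-identityʳ (+ b)) p
... | ℤ.+≤+ q = q

0≤ℕ→ℚ : ∀ k → 0ℚ ≤ ℕ→ℚ k
0≤ℕ→ℚ k = ℕ→ℚ-mono-≤ {0} {k} z≤n

-- recip 0 = 0, the junk value of divℕ.
recip : ℕ → ℚ
recip = divℕ 1

toℚᵘ-recip : ∀ k → ℚ.toℚᵘ (recip (suc k)) ℚᵘ.≃ mkℚᵘ (+ 1) k
toℚᵘ-recip k = ℚP.toℚᵘ-fromℚᵘ (mkℚᵘ (+ 1) k)

0≤recip : ∀ k → 0ℚ ≤ recip k
0≤recip zero    = ℚP.≤-refl
0≤recip (suc k) = ℚP.toℚᵘ-cancel-≤ (ℚᵘP.≤-respʳ-≃ (ℚᵘP.≃-sym (toℚᵘ-recip k)) (*≤* (ℤ.+≤+ z≤n)))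

ℕ→ℚ*recip≡1 : ∀ {k} → 1 ℕ.≤ k → ℕ→ℚ k * recip k ≡ 1ℚ
ℕ→ℚ*recip≡1 {suc k} _ = ℚP.toℚᵘ-injective (begin
  ℚ.toℚᵘ (ℕ→ℚ (suc k) * recip (suc k))             ≈⟨ ℚP.toℚᵘ-homo-* (ℕ→ℚ (suc k)) (recip (suc k)) ⟩
  ℚ.toℚᵘ (ℕ→ℚ (suc k)) ℚᵘ.* ℚ.toℚᵘ (recip (suc k))  ≈⟨ ℚᵘP.*-cong (toℚᵘ-ℕ→ℚ (suc k)) (toℚᵘ-recip k) ⟩
  mkℚᵘ (+ suc k) 0 ℚᵘ.* mkℚᵘ (+ 1) k               ≈⟨ *≡* (unit-product (+ suc k)) ⟩
  ℚᵘ.1ℚᵘ                                             ∎)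
  where
  open ℚᵘP.≃-Reasoning
  unit-product : ∀ x → (x ℤ.* + 1) ℤ.* + 1 ≡ + 1 ℤ.* (+ 1 ℤ.* x)
  unit-product = ℤSolver.solve-∀

ℕ→ℚ*recip≤1 : ∀ k → ℕ→ℚ k * recip k ≤ 1ℚ
ℕ→ℚ*recip≤1 zero    = ℚP.≤ᵇ⇒≤ _
ℕ→ℚ*recip≤1 (suc k) = ℚP.≤-reflexive (ℕ→ℚ*recip≡1 {suc k} (ℕ.s≤s z≤n))

divℕ≡*recip : ∀ a b → divℕ a b ≡ ℕ→ℚ a * recip b
divℕ≡*recip a zero    = sym (ℚP.*-zeroʳ (ℕ→ℚ a))
divℕ≡*recip a (suc k) = ℚP.toℚᵘ-injective (begin
  ℚ.toℚᵘ (divℕ a (suc k))                           ≈⟨ ℚP.toℚᵘ-fromℚᵘ (mkℚᵘ (+ a) k) ⟩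
  mkℚᵘ (+ a) k                                       ≈⟨ *≡* (unit-product (+ a) (+ suc k)) ⟩
  mkℚᵘ (+ a) 0 ℚᵘ.* mkℚᵘ (+ 1) k                    ≈⟨ ℚᵘP.*-cong (ℚᵘP.≃-sym (toℚᵘ-ℕ→ℚ a)) (ℚᵘP.≃-sym (toℚᵘ-recip k)) ⟩
  ℚ.toℚᵘ (ℕ→ℚ a) ℚᵘ.* ℚ.toℚᵘ (recip (suc k))        ≈⟨ ℚᵘP.≃-sym (ℚP.toℚᵘ-homo-* (ℕ→ℚ a) (recip (suc k))) ⟩
  ℚ.toℚᵘ (ℕ→ℚ a * recip (suc k))                    ∎)
  where
  open ℚᵘP.≃-Reasoning
  unit-product : ∀ x y → x ℤ.* (+ 1 ℤ.* y) ≡ (x ℤ.* + 1) ℤ.* y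
  unit-product = ℤSolver.solve-∀

*-monoˡ-≤-nonNeg′ : ∀ {p q} r → 0ℚ ≤ r → p ≤ q → r * p ≤ r * q
*-monoˡ-≤-nonNeg′ r 0≤r = ℚP.*-monoˡ-≤-nonNeg r {{ℚ.nonNegative 0≤r}}

*-monoʳ-≤-nonNeg′ : ∀ {p q} r → 0ℚ ≤ r → p ≤ q → p * r ≤ q * r
*-monoʳ-≤-nonNeg′ r 0≤r = ℚP.*-monoʳ-≤-nonNeg r {{ℚ.nonNegative 0≤r}}

0≤* : ∀ {p q} → 0ℚ ≤ p → 0ℚ ≤ q → 0ℚ ≤ p * q
0≤* {p} {q} 0≤p 0≤q = subst (_≤ p * q) (ℚP.*-zeroˡ q) (*-monoʳ-≤-nonNeg′ q 0≤q 0≤p)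

p≤p+q : ∀ p {q} → 0ℚ ≤ q → p ≤ p + q
p≤p+q p {q} 0≤q = subst (_≤ p + q) (ℚP.+-identityʳ p) (ℚP.+-monoʳ-≤ p 0≤q)

p≤q+p : ∀ p {q} → 0ℚ ≤ q → p ≤ q + p
p≤q+p p {q} 0≤q = subst (_≤ q + p) (ℚP.+-identityˡ p) (ℚP.+-monoˡ-≤ p 0≤q)

p≤q+r⇒p-q≤r : ∀ {p q r} → p ≤ q + r → p - q ≤ r
p≤q+r⇒p-q≤r {p} {q} {r} p≤q+r =
  subst (p - q ≤_) (cancel q r) (ℚP.+-monoˡ-≤ (ℚ.- q) p≤q+r)
  where
  open +-*-Solver using (_:+_; _:-_)
  cancel : ∀ q r → q + r - q ≡ r
  cancel = solve 2 (λ q r → q :+ r :- q := r) refl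

p-q≤r⇒p-r≤q : ∀ {p q r} → p - q ≤ r → p - r ≤ q
p-q≤r⇒p-r≤q {p} {q} {r} p-q≤r = begin
  p - r              ≡⟨ split p q r ⟩
  (p - q) + (q - r)  ≤⟨ ℚP.+-monoˡ-≤ (q - r) p-q≤r ⟩
  r + (q - r)        ≡⟨ cancel r q ⟩
  q                  ∎
  where
  open ℚP.≤-Reasoning
  open +-*-Solver using (_:+_; _:-_)
  split : ∀ p q r → p - r ≡ (p - q) + (q - r)
  split = solve 3 (λ p q r → p :- r := (p :- q) :+ (q :- r)) refl
  cancel : ∀ r q → r + (q - r) ≡ q
  cancel = solve 2 (λ r q → r :+ (q :- r) := q) refl

ℕ→ℚ*recip-cross-≤ : ∀ {a b} p q → 1 ℕ.≤ a → 1 ℕ.≤ b →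
                    p ℕ.* a ℕ.≤ q ℕ.* b → ℕ→ℚ p * recip b ≤ ℕ→ℚ q * recip a
ℕ→ℚ*recip-cross-≤ {a} {b} p q 1≤a 1≤b pa≤qb = begin
  ℕ→ℚ p * recip b                             ≡⟨ clear-denominator p a b 1≤a ⟩
  ℕ→ℚ (p ℕ.* a) * (recip a * recip b)         ≤⟨ *-monoʳ-≤-nonNeg′ _ (0≤* (0≤recip a) (0≤recip b)) (ℕ→ℚ-mono-≤ pa≤qb) ⟩
  ℕ→ℚ (q ℕ.* b) * (recip a * recip b)         ≡⟨ cong (ℕ→ℚ (q ℕ.* b) *_) (ℚP.*-comm (recip a) (recip b)) ⟩
  ℕ→ℚ (q ℕ.* b) * (recip b * recip a)         ≡⟨ clear-denominator q b a 1≤b ⟨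
  ℕ→ℚ q * recip a                             ∎
  where
  open ℚP.≤-Reasoning
  clear-denominator : ∀ x y z → 1 ℕ.≤ y → ℕ→ℚ x * recip z ≡ ℕ→ℚ (x ℕ.* y) * (recip y * recip z)
  clear-denominator x y z 1≤y = begin-equality
    ℕ→ℚ x * recip z                                   ≡⟨ ℚP.*-identityʳ _ ⟨
    ℕ→ℚ x * recip z * 1ℚ                              ≡⟨ cong (ℕ→ℚ x * recip z *_) (ℕ→ℚ*recip≡1 1≤y) ⟨
    ℕ→ℚ x * recip z * (ℕ→ℚ y * recip y)               ≡⟨ regroup (ℕ→ℚ x) (recip z) (ℕ→ℚ y) (recip y) ⟩
    ℕ→ℚ x * ℕ→ℚ y * (recip y * recip z)               ≡⟨ cong (_* (recip y * recip z)) (ℕ→ℚ-* x y) ⟨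
    ℕ→ℚ (x ℕ.* y) * (recip y * recip z)               ∎
    where
    regroup : ∀ x r y s → x * r * (y * s) ≡ x * y * (s * r)
    regroup = solve 4 (λ x r y s → x :* r :* (y :* s) := x :* y :* (s :* r)) refl

recip-antitone : ∀ {a b} → 1 ℕ.≤ a → a ℕ.≤ b → recip b ≤ recip a
recip-antitone {a} {b} 1≤a a≤b = subst₂ _≤_ (ℚP.*-identityˡ (recip b)) (ℚP.*-identityˡ (recip a))
  (ℕ→ℚ*recip-cross-≤ 1 1 1≤a (ℕP.≤-trans 1≤a a≤b) (ℕP.*-monoʳ-≤ 1 a≤b))

𝟙 : Bool → ℚ
𝟙 true  = 1ℚ
𝟙 false = 0ℚ

0≤𝟙 : ∀ b → 0ℚ ≤ 𝟙 b
0≤𝟙 true  = ℚP.≤ᵇ⇒≤ _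
0≤𝟙 false = ℚP.≤-refl

module _ {A : Set} where

  ∑ : List A → (A → ℚ) → ℚ
  ∑ xs g = foldr (λ x acc → g x + acc) 0ℚ xs

  ∑-cong : ∀ xs {g h : A → ℚ} → (∀ x → g x ≡ h x) → ∑ xs g ≡ ∑ xs h
  ∑-cong []       g≡h = refl
  ∑-cong (x ∷ xs) g≡h = cong₂ _+_ (g≡h x) (∑-cong xs g≡h)

  ∑-mono-≤ : ∀ xs {g h : A → ℚ} → (∀ x → g x ≤ h x) → ∑ xs g ≤ ∑ xs h
  ∑-mono-≤ []       g≤h = ℚP.≤-refl
  ∑-mono-≤ (x ∷ xs) g≤h = ℚP.+-mono-≤ (g≤h x) (∑-mono-≤ xs g≤h)

  ∑-zero : ∀ xs → ∑ xs (λ _ → 0ℚ) ≡ 0ℚ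
  ∑-zero []       = refl
  ∑-zero (x ∷ xs) = trans (ℚP.+-identityˡ _) (∑-zero xs)

  ∑-distrib-+ : ∀ xs (g h : A → ℚ) → ∑ xs (λ x → g x + h x) ≡ ∑ xs g + ∑ xs h
  ∑-distrib-+ []       g h = refl
  ∑-distrib-+ (x ∷ xs) g h = trans (cong (_+_ (g x + h x)) (∑-distrib-+ xs g h))
    (interchange (g x) (h x) (∑ xs g) (∑ xs h))
    where
    open +-*-Solver using (_:+_)
    interchange : ∀ a b c d → a + b + (c + d) ≡ a + c + (b + d)
    interchange = solve 4 (λ a b c d → a :+ b :+ (c :+ d) := a :+ c :+ (b :+ d)) refl

  ∑-distrib-+₃ : ∀ xs (g h k : A → ℚ) → ∑ xs (λ x → g x + h x + k x) ≡ ∑ xs g + ∑ xs h + ∑ xs k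
  ∑-distrib-+₃ xs g h k = trans (∑-distrib-+ xs (λ x → g x + h x) k) (cong (_+ ∑ xs k) (∑-distrib-+ xs g h))

  ∑-distribʳ-* : ∀ xs (g : A → ℚ) c → ∑ xs (λ x → g x * c) ≡ ∑ xs g * c
  ∑-distribʳ-* []       g c = sym (ℚP.*-zeroˡ c)
  ∑-distribʳ-* (x ∷ xs) g c =
    trans (cong (_+_ (g x * c)) (∑-distribʳ-* xs g c)) (sym (ℚP.*-distribʳ-+ c (g x) (∑ xs g)))

  ∑-distribˡ-* : ∀ xs (g : A → ℚ) c → ∑ xs (λ x → c * g x) ≡ c * ∑ xs g
  ∑-distribˡ-* xs g c =
    trans (∑-cong xs (λ x → ℚP.*-comm c (g x))) (trans (∑-distribʳ-* xs g c) (ℚP.*-comm _ c))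

  ∑-if : ∀ xs (P : A → Bool) (g : A → ℚ) →
         foldr (λ x acc → if P x then g x + acc else acc) 0ℚ xs ≡ ∑ xs (λ x → if P x then g x else 0ℚ)
  ∑-if []       P g = refl
  ∑-if (x ∷ xs) P g with P x
  ... | true  = cong (_+_ (g x)) (∑-if xs P g)
  ... | false = trans (∑-if xs P g) (sym (ℚP.+-identityˡ _))

∑-comm : ∀ {A B : Set} (xs : List A) (ys : List B) (g : A → B → ℚ) →
         ∑ xs (λ x → ∑ ys (g x)) ≡ ∑ ys (λ y → ∑ xs (λ x → g x y))
∑-comm []       ys g = sym (∑-zero ys)
∑-comm (x ∷ xs) ys g = trans (cong (_+_ (∑ ys (g x))) (∑-comm xs ys g))
  (sym (∑-distrib-+ ys (g x) (λ y → ∑ xs (λ x′ → g x′ y))))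

module _ {A : Set} where

  countIn : List A → (A → Bool) → ℕ
  countIn xs P = foldr (λ x acc → if P x then suc acc else acc) 0 xs

  sumℕ : List A → (A → ℕ) → ℕ
  sumℕ xs g = foldr (λ x acc → g x ℕ.+ acc) 0 xs

  ℕ→ℚ-countIn : ∀ xs P → ℕ→ℚ (countIn xs P) ≡ ∑ xs (λ x → 𝟙 (P x))
  ℕ→ℚ-countIn []       P = refl
  ℕ→ℚ-countIn (x ∷ xs) P with P x
  ... | true  = trans (ℕ→ℚ-+ 1 (countIn xs P)) (cong (_+_ 1ℚ) (ℕ→ℚ-countIn xs P))
  ... | false = trans (ℕ→ℚ-countIn xs P) (sym (ℚP.+-identityˡ _))

  ℕ→ℚ-sumℕ : ∀ xs g → ℕ→ℚ (sumℕ xs g) ≡ ∑ xs (λ x → ℕ→ℚ (g x))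
  ℕ→ℚ-sumℕ []       g = refl
  ℕ→ℚ-sumℕ (x ∷ xs) g = trans (ℕ→ℚ-+ (g x) _) (cong (_+_ (ℕ→ℚ (g x))) (ℕ→ℚ-sumℕ xs g))

  countIn-cong : ∀ xs {P Q : A → Bool} → (∀ x → P x ≡ Q x) → countIn xs P ≡ countIn xs Q
  countIn-cong []       P≡Q = refl
  countIn-cong (x ∷ xs) {P} {Q} P≡Q rewrite P≡Q x =
    cong (λ m → if Q x then suc m else m) (countIn-cong xs P≡Q)

  countIn-mono-≤ : ∀ xs {P Q : A → Bool} → (∀ x → P x ≡ true → Q x ≡ true) →
                   countIn xs P ℕ.≤ countIn xs Q
  countIn-mono-≤ []       P⇒Q = z≤n
  countIn-mono-≤ (x ∷ xs) {P} {Q} P⇒Q with P x in Px | Q x in Qx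
  ... | true  | true  = s≤s (countIn-mono-≤ xs P⇒Q)
  ... | true  | false with () ← trans (sym Qx) (P⇒Q x Px)
  ... | false | true  = ℕP.m≤n⇒m≤1+n (countIn-mono-≤ xs P⇒Q)
  ... | false | false = countIn-mono-≤ xs P⇒Q

  countIn-∨ : ∀ xs (P Q : A → Bool) → countIn xs (λ x → P x ∨ Q x) ℕ.≤ countIn xs P ℕ.+ countIn xs Q
  countIn-∨ []       P Q = z≤n
  countIn-∨ (x ∷ xs) P Q with P x | Q x
  ... | true  | true  = s≤s (ℕP.≤-trans (countIn-∨ xs P Q) (ℕP.+-monoʳ-≤ (countIn xs P) (ℕP.n≤1+n _)))
  ... | true  | false = s≤s (countIn-∨ xs P Q)
  ... | false | true  = ℕP.≤-trans (s≤s (countIn-∨ xs P Q)) (ℕP.≤-reflexive (sym (ℕP.+-suc _ _)))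
  ... | false | false = countIn-∨ xs P Q

  countIn-≤-+ : ∀ xs {P Q R : A → Bool} → (∀ x → P x ≡ true → Q x ∨ R x ≡ true) →
                countIn xs P ℕ.≤ countIn xs Q ℕ.+ countIn xs R
  countIn-≤-+ xs {Q = Q} {R} P⇒Q∨R = ℕP.≤-trans (countIn-mono-≤ xs P⇒Q∨R) (countIn-∨ xs Q R)

  countIn-∈ : ∀ {xs P x} → x ∈ xs → P x ≡ true → 1 ℕ.≤ countIn xs P
  countIn-∈ {P = P} (here refl) Px rewrite Px = s≤s z≤n
  countIn-∈ {y ∷ _} {P} (there x∈xs) Px with P y
  ... | true  = s≤s z≤n
  ... | false = countIn-∈ x∈xs Px

  *-countIn≤*-sumℕ : ∀ xs {P : A → Bool} {g : A → ℕ} a b →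
                     (∀ x → P x ≡ true → a ℕ.≤ b ℕ.* g x) → a ℕ.* countIn xs P ℕ.≤ b ℕ.* sumℕ xs g
  *-countIn≤*-sumℕ []       a b bound = ℕP.≤-reflexive (trans (ℕP.*-zeroʳ a) (sym (ℕP.*-zeroʳ b)))
  *-countIn≤*-sumℕ (x ∷ xs) {P} {g} a b bound with P x in Px
  ... | true  = begin
    a ℕ.* suc (countIn xs P)             ≡⟨ ℕP.*-suc a _ ⟩
    a ℕ.+ a ℕ.* countIn xs P             ≤⟨ ℕP.+-mono-≤ (bound x Px) (*-countIn≤*-sumℕ xs a b bound) ⟩
    b ℕ.* g x ℕ.+ b ℕ.* sumℕ xs g        ≡⟨ ℕP.*-distribˡ-+ b (g x) _ ⟨
    b ℕ.* (g x ℕ.+ sumℕ xs g)            ∎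
    where open ℕP.≤-Reasoning
  ... | false = ℕP.≤-trans (*-countIn≤*-sumℕ xs a b bound) (ℕP.*-monoʳ-≤ b (ℕP.m≤n+m _ (g x)))

does⇒ : ∀ {P : Set} (P? : Dec P) → ⌊ P? ⌋ ≡ true → P
does⇒ (yes p) _ = p

¬does⇒ : ∀ {P : Set} (P? : Dec P) → ⌊ P? ⌋ ≡ false → ¬ P
¬does⇒ (no ¬p) _ = ¬p

1≤𝟙+𝟙 : ∀ a b → a ∨ b ≡ true → 1ℚ ≤ 𝟙 a + 𝟙 b
1≤𝟙+𝟙 true  b _ = p≤p+q 1ℚ (0≤𝟙 b)
1≤𝟙+𝟙 false true _ = ℚP.≤-refl

-- The charging argument

module Charging {n : ℕ} (G : SignedGraph n) (G-sym : ∀ u v → G u v ≡ G v u)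
                (G-refl : ∀ u → G u u ≡ true) (c : Clustering G) where

  V : List (Fin n)
  V = allFin n

  ∑V : (Fin n → ℚ) → ℚ
  ∑V = ∑ V

  same : Fin n → Fin n → Bool
  same = sameCluster G c

  disagree : Fin n → Fin n → Bool
  disagree u v = (G u v ∧ not (same u v)) ∨ (not (G u v) ∧ same u v)

  yℚ : Fin n → ℚ
  yℚ u = ℕ→ℚ (y G c u)

  Δ≥1 : ∀ u → 1 ℕ.≤ Δ G u
  Δ≥1 u = countIn-∈ (∈-allFin u) (G-refl u)

  same-refl : ∀ u → same u u ≡ true
  same-refl u with c u ≟ c u
  ... | yes _    = refl
  ... | no  cu≢cu = contradiction refl cu≢cu

  same-sym : ∀ u v → same u v ≡ same v u
  same-sym u v with c u ≟ c v | c v ≟ c u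
  ... | yes _     | yes _     = refl
  ... | no  _     | no  _     = refl
  ... | yes cu≡cv | no  cv≢cu = contradiction (sym cu≡cv) cv≢cu
  ... | no  cu≢cv | yes cv≡cu = contradiction (sym cv≡cu) cu≢cv

  same-trans : ∀ {u v} → same u v ≡ true → ∀ w → same u w ≡ same v w
  same-trans {u} {v} uv w rewrite does⇒ (c u ≟ c v) uv = refl

  disagree-cut : ∀ {u v} → G u v ≡ true → same u v ≡ false → disagree u v ≡ true
  disagree-cut Guv ¬uv rewrite Guv | ¬uv = refl

  cost≡∑y : ℕ→ℚ (cost G c) ≡ ∑V yℚ
  cost≡∑y = ℕ→ℚ-sumℕ V (y G c)

  ∣∪∣ ∣∩∣ : Fin n → Fin n → ℕ
  ∣∪∣ u v = count (λ w → G u w ∨ G v w)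
  ∣∩∣ u v = count (λ w → G u w ∧ G v w)

  d≡1-∩/∪ : ∀ u v → d G u v ≡ 1ℚ - ℕ→ℚ (∣∩∣ u v) * recip (∣∪∣ u v)
  d≡1-∩/∪ u v = cong (λ q → 1ℚ - q) (divℕ≡*recip (∣∩∣ u v) (∣∪∣ u v))

  Δ≤∣∪∣ˡ : ∀ u v → Δ G u ℕ.≤ ∣∪∣ u v
  Δ≤∣∪∣ˡ u v = countIn-mono-≤ V (λ w Guw → cong (_∨ G v w) Guw)

  Δ≤∣∪∣ʳ : ∀ u v → Δ G v ℕ.≤ ∣∪∣ u v
  Δ≤∣∪∣ʳ u v = countIn-mono-≤ V (λ w Gvw → trans (cong (G u w ∨_) Gvw) (∨-zeroʳ (G u w)))

  d≤1 : ∀ u v → d G u v ≤ 1ℚ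
  d≤1 u v = subst (_≤ 1ℚ) (sym (d≡1-∩/∪ u v))
    (p≤q+r⇒p-q≤r {q = ℕ→ℚ (∣∩∣ u v) * recip (∣∪∣ u v)} (p≤q+p 1ℚ (0≤* (0≤ℕ→ℚ (∣∩∣ u v)) (0≤recip (∣∪∣ u v)))))

  ∣∪∣≤∣∩∣+y+y : ∀ u v → same u v ≡ true → ∣∪∣ u v ℕ.≤ ∣∩∣ u v ℕ.+ (y G c u ℕ.+ y G c v)
  ∣∪∣≤∣∩∣+y+y u v uv = ℕP.≤-trans (countIn-≤-+ V covered)
    (ℕP.+-monoʳ-≤ (∣∩∣ u v) (countIn-∨ V (disagree u) (disagree v)))
    where
    cover : ∀ a b s → a ∨ b ≡ true →
            (a ∧ b) ∨ (((a ∧ not s) ∨ (not a ∧ s)) ∨ ((b ∧ not s) ∨ (not b ∧ s))) ≡ true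
    cover true  true  s     _ = refl
    cover true  false true  _ = refl
    cover true  false false _ = refl
    cover false true  true  _ = refl
    cover false true  false _ = refl
    covered : ∀ w → G u w ∨ G v w ≡ true → (G u w ∧ G v w) ∨ (disagree u w ∨ disagree v w) ≡ true
    covered w rewrite same-trans uv w = cover (G u w) (G v w) (same v w)

  y/Δ : Fin n → ℚ
  y/Δ u = yℚ u * recip (Δ G u)

  0≤y/Δ : ∀ u → 0ℚ ≤ y/Δ u
  0≤y/Δ u = 0≤* (0≤ℕ→ℚ (y G c u)) (0≤recip (Δ G u))

  d≤y/Δ+y/Δ : ∀ u v → same u v ≡ true → d G u v ≤ y/Δ u + y/Δ v
  d≤y/Δ+y/Δ u v uv = begin
    d G u v                                      ≡⟨ d≡1-∩/∪ u v ⟩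
    1ℚ - ℕ→ℚ ∩ * recip ∪                         ≤⟨ p≤q+r⇒p-q≤r {q = ℕ→ℚ ∩ * recip ∪} 1≤ ⟩
    (yℚ u + yℚ v) * recip ∪                      ≡⟨ ℚP.*-distribʳ-+ (recip ∪) (yℚ u) (yℚ v) ⟩
    yℚ u * recip ∪ + yℚ v * recip ∪              ≤⟨ ℚP.+-mono-≤ (shrink u (Δ≤∣∪∣ˡ u v)) (shrink v (Δ≤∣∪∣ʳ u v)) ⟩
    y/Δ u + y/Δ v                                ∎
    where
    open ℚP.≤-Reasoning
    ∪ ∩ : ℕ
    ∪ = ∣∪∣ u v
    ∩ = ∣∩∣ u v
    shrink : ∀ x → Δ G x ℕ.≤ ∪ → yℚ x * recip ∪ ≤ y/Δ x
    shrink x Δ≤∪ = *-monoˡ-≤-nonNeg′ (yℚ x) (0≤ℕ→ℚ (y G c x)) (recip-antitone (Δ≥1 x) Δ≤∪)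
    1≤ : 1ℚ ≤ ℕ→ℚ ∩ * recip ∪ + (yℚ u + yℚ v) * recip ∪
    1≤ = begin
      1ℚ                                            ≡⟨ ℕ→ℚ*recip≡1 (ℕP.≤-trans (Δ≥1 u) (Δ≤∣∪∣ˡ u v)) ⟨
      ℕ→ℚ ∪ * recip ∪                               ≤⟨ *-monoʳ-≤-nonNeg′ (recip ∪) (0≤recip ∪) (ℕ→ℚ-mono-≤ (∣∪∣≤∣∩∣+y+y u v uv)) ⟩
      ℕ→ℚ (∩ ℕ.+ (y G c u ℕ.+ y G c v)) * recip ∪    ≡⟨ cong (_* recip ∪) (trans (ℕ→ℚ-+ ∩ (y G c u ℕ.+ y G c v)) (cong (_+_ (ℕ→ℚ ∩)) (ℕ→ℚ-+ (y G c u) (y G c v)))) ⟩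
      (ℕ→ℚ ∩ + (yℚ u + yℚ v)) * recip ∪             ≡⟨ ℚP.*-distribʳ-+ (recip ∪) (ℕ→ℚ ∩) _ ⟩
      ℕ→ℚ ∩ * recip ∪ + (yℚ u + yℚ v) * recip ∪     ∎

  close : Fin n → Fin n → Bool
  close u v = ⌊ d G u v ℚP.≤? seven-tenths G ⌋

  -- 3 = 10 · (1 - 7/10) holds by evaluation.
  close⇒3∣∪∣≤10∣∩∣ : ∀ u v → close u v ≡ true → 3 ℕ.* ∣∪∣ u v ℕ.≤ 10 ℕ.* ∣∩∣ u v
  close⇒3∣∪∣≤10∣∩∣ u v uv-close = ℕ→ℚ-cancel-≤ (begin
    ℕ→ℚ (3 ℕ.* ∪)                            ≡⟨ ℕ→ℚ-* 3 ∪ ⟩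
    ℕ→ℚ 3 * ℕ→ℚ ∪                            ≡⟨ ℚP.*-assoc (ℕ→ℚ 10) (1ℚ - seven-tenths G) (ℕ→ℚ ∪) ⟩
    ℕ→ℚ 10 * ((1ℚ - seven-tenths G) * ℕ→ℚ ∪)  ≤⟨ *-monoˡ-≤-nonNeg′ (ℕ→ℚ 10) (0≤ℕ→ℚ 10) (*-monoʳ-≤-nonNeg′ (ℕ→ℚ ∪) (0≤ℕ→ℚ ∪) 0·3≤∩/∪) ⟩
    ℕ→ℚ 10 * (ℕ→ℚ ∩ * recip ∪ * ℕ→ℚ ∪)        ≡⟨ cong (ℕ→ℚ 10 *_) (trans (ℚP.*-assoc (ℕ→ℚ ∩) (recip ∪) (ℕ→ℚ ∪)) (cong (ℕ→ℚ ∩ *_) (ℚP.*-comm (recip ∪) (ℕ→ℚ ∪)))) ⟩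
    ℕ→ℚ 10 * (ℕ→ℚ ∩ * (ℕ→ℚ ∪ * recip ∪))      ≤⟨ *-monoˡ-≤-nonNeg′ (ℕ→ℚ 10) (0≤ℕ→ℚ 10) (*-monoˡ-≤-nonNeg′ (ℕ→ℚ ∩) (0≤ℕ→ℚ ∩) (ℕ→ℚ*recip≤1 ∪)) ⟩
    ℕ→ℚ 10 * (ℕ→ℚ ∩ * 1ℚ)                    ≡⟨ cong (ℕ→ℚ 10 *_) (ℚP.*-identityʳ (ℕ→ℚ ∩)) ⟩
    ℕ→ℚ 10 * ℕ→ℚ ∩                           ≡⟨ ℕ→ℚ-* 10 ∩ ⟨
    ℕ→ℚ (10 ℕ.* ∩)                           ∎)
    where
    open ℚP.≤-Reasoning
    ∪ ∩ : ℕ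
    ∪ = ∣∪∣ u v
    ∩ = ∣∩∣ u v
    0·3≤∩/∪ : 1ℚ - seven-tenths G ≤ ℕ→ℚ ∩ * recip ∪
    0·3≤∩/∪ = p-q≤r⇒p-r≤q (subst (_≤ seven-tenths G) (d≡1-∩/∪ u v) (does⇒ (d G u v ℚP.≤? seven-tenths G) uv-close))

  negClose : Fin n → Fin n → Bool
  negClose u v = not (G u v) ∧ close u v

  -- 10 = 3 · (10/3) holds by evaluation.
  bad⇒10Δ≤3#negClose : ∀ u → bad G u ≡ true → 10 ℕ.* Δ G u ℕ.≤ 3 ℕ.* count (negClose u)
  bad⇒10Δ≤3#negClose u u-bad = ℕ→ℚ-cancel-≤ (begin
    ℕ→ℚ (10 ℕ.* Δ G u)                  ≡⟨ ℕ→ℚ-* 10 (Δ G u) ⟩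
    ℕ→ℚ 10 * ℕ→ℚ (Δ G u)                ≡⟨ ℚP.*-assoc (ℕ→ℚ 3) (+ 10 / 3) (ℕ→ℚ (Δ G u)) ⟩
    ℕ→ℚ 3 * ((+ 10 / 3) * ℕ→ℚ (Δ G u))  ≤⟨ *-monoˡ-≤-nonNeg′ (ℕ→ℚ 3) (0≤ℕ→ℚ 3) (does⇒ (_ ℚP.≤? _) u-bad) ⟩
    ℕ→ℚ 3 * ℕ→ℚ (count (negClose u))    ≡⟨ ℕ→ℚ-* 3 (count (negClose u)) ⟨
    ℕ→ℚ (3 ℕ.* count (negClose u))      ∎)
    where open ℚP.≤-Reasoning

  f-positive-edge : ∀ u v → G u v ≡ true → (bad G u ∨ bad G v ≡ true × f G u v ≡ 1ℚ) ⊎ f G u v ≡ d G u v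
  f-positive-edge u v Guv = by-cases (not ⌊ u ≟ v ⌋ ∧ (bad G u ∨ bad G v)) refl
    where
    f-before-step3 : ℚ
    f-before-step3 = if not (G u v) ∧ ⌊ seven-tenths G ℚP.<? d G u v ⌋ then 1ℚ else d G u v
    f-before-step3≡d : f-before-step3 ≡ d G u v
    f-before-step3≡d = cong (λ b → if not b ∧ ⌊ seven-tenths G ℚP.<? d G u v ⌋ then 1ℚ else d G u v) Guv
    by-cases : ∀ b → not ⌊ u ≟ v ⌋ ∧ (bad G u ∨ bad G v) ≡ b →
               (bad G u ∨ bad G v ≡ true × f G u v ≡ 1ℚ) ⊎ f G u v ≡ d G u v
    by-cases true  override = inj₁ (∧-conicalʳ _ _ override , cong (λ b → if b then 1ℚ else f-before-step3) override)
    by-cases false override = inj₂ (trans (cong (λ b → if b then 1ℚ else f-before-step3) override) f-before-step3≡d)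

  charge : Fin n → ℚ
  charge u = 𝟙 (bad G u) + y/Δ u

  0≤charge : ∀ u → 0ℚ ≤ charge u
  0≤charge u = ℚP.+-mono-≤ (0≤𝟙 (bad G u)) (0≤y/Δ u)

  𝟙bad≤charge : ∀ u → 𝟙 (bad G u) ≤ charge u
  𝟙bad≤charge u = p≤p+q (𝟙 (bad G u)) (0≤y/Δ u)

  y/Δ≤charge : ∀ u → y/Δ u ≤ charge u
  y/Δ≤charge u = p≤q+p (y/Δ u) (0≤𝟙 (bad G u))

  1≤charge : ∀ u v → bad G u ∨ bad G v ≡ true → 1ℚ ≤ charge u + charge v + 𝟙 (disagree u v)
  1≤charge u v u∨v-bad = begin
    1ℚ                                     ≤⟨ 1≤𝟙+𝟙 (bad G u) (bad G v) u∨v-bad ⟩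
    𝟙 (bad G u) + 𝟙 (bad G v)              ≤⟨ ℚP.+-mono-≤ (𝟙bad≤charge u) (𝟙bad≤charge v) ⟩
    charge u + charge v                    ≤⟨ p≤p+q (charge u + charge v) (0≤𝟙 (disagree u v)) ⟩
    charge u + charge v + 𝟙 (disagree u v) ∎
    where open ℚP.≤-Reasoning

  d≤charge : ∀ u v → G u v ≡ true → d G u v ≤ charge u + charge v + 𝟙 (disagree u v)
  d≤charge u v Guv = by-cluster (same u v) refl
    where
    open ℚP.≤-Reasoning
    by-cluster : ∀ s → same u v ≡ s → d G u v ≤ charge u + charge v + 𝟙 (disagree u v)
    by-cluster true  uv = begin
      d G u v                                ≤⟨ d≤y/Δ+y/Δ u v uv ⟩
      y/Δ u + y/Δ v                          ≤⟨ ℚP.+-mono-≤ (y/Δ≤charge u) (y/Δ≤charge v) ⟩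
      charge u + charge v                    ≤⟨ p≤p+q (charge u + charge v) (0≤𝟙 (disagree u v)) ⟩
      charge u + charge v + 𝟙 (disagree u v) ∎
    by-cluster false uv = begin
      d G u v                                ≤⟨ d≤1 u v ⟩
      1ℚ                                     ≡⟨ cong 𝟙 (disagree-cut Guv uv) ⟨
      𝟙 (disagree u v)                       ≤⟨ p≤q+p (𝟙 (disagree u v)) (ℚP.+-mono-≤ (0≤charge u) (0≤charge v)) ⟩
      charge u + charge v + 𝟙 (disagree u v) ∎

  f≤charge : ∀ u v → G u v ≡ true → f G u v ≤ charge u + charge v + 𝟙 (disagree u v)
  f≤charge u v Guv = [ (λ { (u∨v-bad , f≡1) → subst (_≤ total) (sym f≡1) (1≤charge u v u∨v-bad) })
                     , (λ f≡d → subst (_≤ total) (sym f≡d) (d≤charge u v Guv)) ]′ (f-positive-edge u v Guv)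
    where
    total : ℚ
    total = charge u + charge v + 𝟙 (disagree u v)

  positive-term≤charges : ∀ u v → (if G u v then f G u v else 0ℚ) ≤
                          𝟙 (G u v) * charge u + 𝟙 (G u v) * charge v + 𝟙 (disagree u v)
  positive-term≤charges u v = by-sign (G u v) refl
    where
    by-sign : ∀ b → G u v ≡ b → (if b then f G u v else 0ℚ) ≤ 𝟙 b * charge u + 𝟙 b * charge v + 𝟙 (disagree u v)
    by-sign true  Guv = subst₂ (λ p q → f G u v ≤ p + q + 𝟙 (disagree u v))
      (sym (ℚP.*-identityˡ (charge u))) (sym (ℚP.*-identityˡ (charge v))) (f≤charge u v Guv)
    by-sign false _   = ℚP.+-mono-≤ (ℚP.+-mono-≤ (0≤* ℚP.≤-refl (0≤charge u)) (0≤* ℚP.≤-refl (0≤charge v)))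
                                    (0≤𝟙 (disagree u v))

  ∑Δcharge : ℚ
  ∑Δcharge = ∑V (λ u → ℕ→ℚ (Δ G u) * charge u)

  ∑∑-own-charge : ∑V (λ u → ∑V (λ v → 𝟙 (G u v) * charge u)) ≡ ∑Δcharge
  ∑∑-own-charge = ∑-cong V (λ u →
    trans (∑-distribʳ-* V (λ v → 𝟙 (G u v)) (charge u)) (cong (_* charge u) (sym (ℕ→ℚ-countIn V (G u)))))

  ∑∑-other-charge : ∑V (λ u → ∑V (λ v → 𝟙 (G u v) * charge v)) ≡ ∑Δcharge
  ∑∑-other-charge = begin
    ∑V (λ u → ∑V (λ v → 𝟙 (G u v) * charge v))  ≡⟨ ∑-comm V V (λ u v → 𝟙 (G u v) * charge v) ⟩
    ∑V (λ v → ∑V (λ u → 𝟙 (G u v) * charge v))  ≡⟨ ∑-cong V (λ v → ∑-cong V (λ u → cong (λ b → 𝟙 b * charge v) (G-sym u v))) ⟩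
    ∑V (λ v → ∑V (λ u → 𝟙 (G v u) * charge v))  ≡⟨ ∑∑-own-charge ⟩
    ∑Δcharge                                     ∎
    where open ≡-Reasoning

  ∑∑-disagree : ∑V (λ u → ∑V (λ v → 𝟙 (disagree u v))) ≡ ℕ→ℚ (cost G c)
  ∑∑-disagree = trans (∑-cong V (λ u → sym (ℕ→ℚ-countIn V (disagree u)))) (sym cost≡∑y)

  fPositiveSum≤∑Δcharge+∑Δcharge+cost : fPositiveSum G ≤ ∑Δcharge + ∑Δcharge + ℕ→ℚ (cost G c)
  fPositiveSum≤∑Δcharge+∑Δcharge+cost = begin
    fPositiveSum G                                        ≡⟨ ∑-cong V (λ u → ∑-if V (G u) (f G u)) ⟩
    ∑V (λ u → ∑V (λ v → if G u v then f G u v else 0ℚ))   ≤⟨ ∑-mono-≤ V (λ u → ∑-mono-≤ V (positive-term≤charges u)) ⟩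
    ∑V (λ u → ∑V (λ v → own u v + other u v + dis u v))   ≡⟨ split ⟩
    ∑∑ own + ∑∑ other + ∑∑ dis                            ≡⟨ cong₂ _+_ (cong₂ _+_ ∑∑-own-charge ∑∑-other-charge) ∑∑-disagree ⟩
    ∑Δcharge + ∑Δcharge + ℕ→ℚ (cost G c)                  ∎
    where
    open ℚP.≤-Reasoning
    ∑∑ : (Fin n → Fin n → ℚ) → ℚ
    ∑∑ g = ∑V (λ u → ∑V (g u))
    own other dis : Fin n → Fin n → ℚ
    own   u v = 𝟙 (G u v) * charge u
    other u v = 𝟙 (G u v) * charge v
    dis   u v = 𝟙 (disagree u v)
    split : ∑V (λ u → ∑V (λ v → own u v + other u v + dis u v)) ≡ ∑∑ own + ∑∑ other + ∑∑ dis
    split = trans (∑-cong V (λ u → ∑-distrib-+₃ V (own u) (other u) (dis u)))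
                  (∑-distrib-+₃ V (λ u → ∑V (own u)) (λ u → ∑V (other u)) (λ u → ∑V (dis u)))

  -- Bad vertices

  light : Fin n → Bool
  light u = ⌊ 8 ℕ.* y G c u ℕP.<? Δ G u ⌋

  light⇒8y≤Δ : ∀ u → light u ≡ true → 8 ℕ.* y G c u ℕ.≤ Δ G u
  light⇒8y≤Δ u u-light = ℕP.<⇒≤ (does⇒ (8 ℕ.* y G c u ℕP.<? Δ G u) u-light)

  heavy⇒Δ≤8y : ∀ u → light u ≡ false → Δ G u ℕ.≤ 8 ℕ.* y G c u
  heavy⇒Δ≤8y u u-heavy = ℕP.≮⇒≥ (¬does⇒ (8 ℕ.* y G c u ℕP.<? Δ G u) u-heavy)

  separatedClose : Fin n → Fin n → Bool
  separatedClose u v = negClose u v ∧ not (same u v)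

  commonInCluster : Fin n → Fin n → Fin n → Bool
  commonInCluster u v w = (G u w ∧ G v w) ∧ same u w

  witness : Fin n → Fin n → Fin n → Bool
  witness u v w = light u ∧ separatedClose u v ∧ commonInCluster u v w

  Z : Fin n → ℕ
  Z u = sumℕ V (λ v → count (witness u v))

  #negClose≤#separatedClose+y : ∀ u → count (negClose u) ℕ.≤ count (separatedClose u) ℕ.+ y G c u
  #negClose≤#separatedClose+y u = countIn-≤-+ V (λ v → cover (G u v) (close u v) (same u v))
    where
    cover : ∀ g cl s → not g ∧ cl ≡ true → ((not g ∧ cl) ∧ not s) ∨ ((g ∧ not s) ∨ (not g ∧ s)) ≡ true
    cover false true true  _ = refl
    cover false true false _ = refl

  ∣∩∣≤#commonInCluster+y : ∀ u v → ∣∩∣ u v ℕ.≤ count (commonInCluster u v) ℕ.+ y G c u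
  ∣∩∣≤#commonInCluster+y u v = countIn-≤-+ V (λ w → cover (G u w) (G v w) (same u w))
    where
    cover : ∀ gu gv s → gu ∧ gv ≡ true → ((gu ∧ gv) ∧ s) ∨ ((gu ∧ not s) ∨ (not gu ∧ s)) ≡ true
    cover true true true  _ = refl
    cover true true false _ = refl

  separatedClose⇒7Δ≤40#commonInCluster : ∀ u v → light u ≡ true → separatedClose u v ≡ true →
                                        7 ℕ.* Δ G u ℕ.≤ 40 ℕ.* count (commonInCluster u v)
  separatedClose⇒7Δ≤40#commonInCluster u v u-light uv-sep =
    absorb-y (Δ G u) (count (commonInCluster u v)) (y G c u) 3Δ≤10k+10y (light⇒8y≤Δ u u-light)
    where
    open ℕP.≤-Reasoning
    uv-close : close u v ≡ true
    uv-close = ∧-conicalʳ (not (G u v)) (close u v) (∧-conicalˡ (negClose u v) (not (same u v)) uv-sep)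
    3Δ≤10k+10y : 3 ℕ.* Δ G u ℕ.≤ 10 ℕ.* count (commonInCluster u v) ℕ.+ 10 ℕ.* y G c u
    3Δ≤10k+10y = begin
      3 ℕ.* Δ G u                                       ≤⟨ ℕP.*-monoʳ-≤ 3 (Δ≤∣∪∣ˡ u v) ⟩
      3 ℕ.* ∣∪∣ u v                                     ≤⟨ close⇒3∣∪∣≤10∣∩∣ u v uv-close ⟩
      10 ℕ.* ∣∩∣ u v                                    ≤⟨ ℕP.*-monoʳ-≤ 10 (∣∩∣≤#commonInCluster+y u v) ⟩
      10 ℕ.* (count (commonInCluster u v) ℕ.+ y G c u)  ≡⟨ ℕP.*-distribˡ-+ 10 (count (commonInCluster u v)) (y G c u) ⟩
      10 ℕ.* count (commonInCluster u v) ℕ.+ 10 ℕ.* y G c u ∎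
    absorb-y : ∀ D k y → 3 ℕ.* D ℕ.≤ 10 ℕ.* k ℕ.+ 10 ℕ.* y → 8 ℕ.* y ℕ.≤ D → 7 ℕ.* D ℕ.≤ 40 ℕ.* k
    absorb-y D k y 3D≤ 8y≤D = ℕP.+-cancelʳ-≤ (5 ℕ.* D) (7 ℕ.* D) (40 ℕ.* k) (begin
      7 ℕ.* D ℕ.+ 5 ℕ.* D             ≡⟨ regroupˡ D ⟩
      4 ℕ.* (3 ℕ.* D)                 ≤⟨ ℕP.*-monoʳ-≤ 4 3D≤ ⟩
      4 ℕ.* (10 ℕ.* k ℕ.+ 10 ℕ.* y)   ≡⟨ regroupʳ k y ⟩
      40 ℕ.* k ℕ.+ 5 ℕ.* (8 ℕ.* y)    ≤⟨ ℕP.+-monoʳ-≤ (40 ℕ.* k) (ℕP.*-monoʳ-≤ 5 8y≤D) ⟩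
      40 ℕ.* k ℕ.+ 5 ℕ.* D            ∎)
      where
      regroupˡ : ∀ D → 7 ℕ.* D ℕ.+ 5 ℕ.* D ≡ 4 ℕ.* (3 ℕ.* D)
      regroupˡ = solve-∀
      regroupʳ : ∀ k y → 4 ℕ.* (10 ℕ.* k ℕ.+ 10 ℕ.* y) ≡ 40 ℕ.* k ℕ.+ 5 ℕ.* (8 ℕ.* y)
      regroupʳ = solve-∀

  #witness≡#commonInCluster : ∀ u v → light u ≡ true → separatedClose u v ≡ true →
                              count (witness u v) ≡ count (commonInCluster u v)
  #witness≡#commonInCluster u v u-light uv-sep =
    countIn-cong V (λ w → cong₂ (λ a b → a ∧ b ∧ commonInCluster u v w) u-light uv-sep)

  7Δ*#separatedClose≤40Z : ∀ u → light u ≡ true → 7 ℕ.* Δ G u ℕ.* count (separatedClose u) ℕ.≤ 40 ℕ.* Z u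
  7Δ*#separatedClose≤40Z u u-light = *-countIn≤*-sumℕ V (7 ℕ.* Δ G u) 40 (λ v uv-sep →
    subst (λ k → 7 ℕ.* Δ G u ℕ.≤ 40 ℕ.* k) (sym (#witness≡#commonInCluster u v u-light uv-sep))
      (separatedClose⇒7Δ≤40#commonInCluster u v u-light uv-sep))

  bad⇒77Δ≤24#separatedClose : ∀ u → bad G u ≡ true → light u ≡ true →
                              77 ℕ.* Δ G u ℕ.≤ 24 ℕ.* count (separatedClose u)
  bad⇒77Δ≤24#separatedClose u u-bad u-light =
    absorb-y (Δ G u) (count (separatedClose u)) (y G c u) 10Δ≤3s+3y (light⇒8y≤Δ u u-light)
    where
    open ℕP.≤-Reasoning
    10Δ≤3s+3y : 10 ℕ.* Δ G u ℕ.≤ 3 ℕ.* count (separatedClose u) ℕ.+ 3 ℕ.* y G c u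
    10Δ≤3s+3y = begin
      10 ℕ.* Δ G u                                       ≤⟨ bad⇒10Δ≤3#negClose u u-bad ⟩
      3 ℕ.* count (negClose u)                           ≤⟨ ℕP.*-monoʳ-≤ 3 (#negClose≤#separatedClose+y u) ⟩
      3 ℕ.* (count (separatedClose u) ℕ.+ y G c u)       ≡⟨ ℕP.*-distribˡ-+ 3 (count (separatedClose u)) (y G c u) ⟩
      3 ℕ.* count (separatedClose u) ℕ.+ 3 ℕ.* y G c u   ∎
    absorb-y : ∀ D s y → 10 ℕ.* D ℕ.≤ 3 ℕ.* s ℕ.+ 3 ℕ.* y → 8 ℕ.* y ℕ.≤ D → 77 ℕ.* D ℕ.≤ 24 ℕ.* s
    absorb-y D s y 10D≤ 8y≤D = ℕP.+-cancelʳ-≤ (3 ℕ.* D) (77 ℕ.* D) (24 ℕ.* s) (begin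
      77 ℕ.* D ℕ.+ 3 ℕ.* D          ≡⟨ regroupˡ D ⟩
      8 ℕ.* (10 ℕ.* D)              ≤⟨ ℕP.*-monoʳ-≤ 8 10D≤ ⟩
      8 ℕ.* (3 ℕ.* s ℕ.+ 3 ℕ.* y)   ≡⟨ regroupʳ s y ⟩
      24 ℕ.* s ℕ.+ 3 ℕ.* (8 ℕ.* y)  ≤⟨ ℕP.+-monoʳ-≤ (24 ℕ.* s) (ℕP.*-monoʳ-≤ 3 8y≤D) ⟩
      24 ℕ.* s ℕ.+ 3 ℕ.* D          ∎)
      where
      regroupˡ : ∀ D → 77 ℕ.* D ℕ.+ 3 ℕ.* D ≡ 8 ℕ.* (10 ℕ.* D)
      regroupˡ = solve-∀
      regroupʳ : ∀ s y → 8 ℕ.* (3 ℕ.* s ℕ.+ 3 ℕ.* y) ≡ 24 ℕ.* s ℕ.+ 3 ℕ.* (8 ℕ.* y)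
      regroupʳ = solve-∀

  Δ²≤2Z : ∀ u → bad G u ≡ true → light u ≡ true → Δ G u ℕ.* Δ G u ℕ.≤ 2 ℕ.* Z u
  Δ²≤2Z u u-bad u-light = combine (Δ G u) (count (separatedClose u)) (Z u)
    (bad⇒77Δ≤24#separatedClose u u-bad u-light) (7Δ*#separatedClose≤40Z u u-light)
    where
    open ℕP.≤-Reasoning
    combine : ∀ D s z → 77 ℕ.* D ℕ.≤ 24 ℕ.* s → 7 ℕ.* D ℕ.* s ℕ.≤ 40 ℕ.* z → D ℕ.* D ℕ.≤ 2 ℕ.* z
    combine D s z 77D≤24s 7Ds≤40z = ℕP.*-cancelˡ-≤ 960 (begin
      960 ℕ.* (D ℕ.* D)                  ≤⟨ ℕP.*-monoˡ-≤ (D ℕ.* D) (ℕP.m≤m+n 960 118) ⟩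
      1078 ℕ.* (D ℕ.* D)                 ≡⟨ regroup₁ D ⟩
      2 ℕ.* (7 ℕ.* D ℕ.* (77 ℕ.* D))     ≤⟨ ℕP.*-monoʳ-≤ 2 (ℕP.*-monoʳ-≤ (7 ℕ.* D) 77D≤24s) ⟩
      2 ℕ.* (7 ℕ.* D ℕ.* (24 ℕ.* s))     ≡⟨ regroup₂ D s ⟩
      48 ℕ.* (7 ℕ.* D ℕ.* s)             ≤⟨ ℕP.*-monoʳ-≤ 48 7Ds≤40z ⟩
      48 ℕ.* (40 ℕ.* z)                  ≡⟨ regroup₃ z ⟩
      960 ℕ.* (2 ℕ.* z)                  ∎)
      where
      regroup₁ : ∀ D → 1078 ℕ.* (D ℕ.* D) ≡ 2 ℕ.* (7 ℕ.* D ℕ.* (77 ℕ.* D))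
      regroup₁ = solve-∀
      regroup₂ : ∀ D s → 2 ℕ.* (7 ℕ.* D ℕ.* (24 ℕ.* s)) ≡ 48 ℕ.* (7 ℕ.* D ℕ.* s)
      regroup₂ = solve-∀
      regroup₃ : ∀ z → 48 ℕ.* (40 ℕ.* z) ≡ 960 ℕ.* (2 ℕ.* z)
      regroup₃ = solve-∀

  Z/Δ : Fin n → ℚ
  Z/Δ u = ℕ→ℚ (Z u) * recip (Δ G u)

  0≤Z/Δ : ∀ u → 0ℚ ≤ Z/Δ u
  0≤Z/Δ u = 0≤* (0≤ℕ→ℚ (Z u)) (0≤recip (Δ G u))

  Δ≤2Z/Δ : ∀ u → bad G u ≡ true → light u ≡ true → ℕ→ℚ (Δ G u) ≤ ℕ→ℚ 2 * Z/Δ u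
  Δ≤2Z/Δ u u-bad u-light = begin
    Δ′                                    ≡⟨ ℚP.*-identityʳ Δ′ ⟨
    Δ′ * 1ℚ                               ≡⟨ cong (Δ′ *_) (ℕ→ℚ*recip≡1 (Δ≥1 u)) ⟨
    Δ′ * (Δ′ * recip (Δ G u))             ≡⟨ ℚP.*-assoc Δ′ Δ′ (recip (Δ G u)) ⟨
    Δ′ * Δ′ * recip (Δ G u)               ≡⟨ cong (_* recip (Δ G u)) (ℕ→ℚ-* (Δ G u) (Δ G u)) ⟨
    ℕ→ℚ (Δ G u ℕ.* Δ G u) * recip (Δ G u) ≤⟨ *-monoʳ-≤-nonNeg′ (recip (Δ G u)) (0≤recip (Δ G u)) (ℕ→ℚ-mono-≤ (Δ²≤2Z u u-bad u-light)) ⟩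
    ℕ→ℚ (2 ℕ.* Z u) * recip (Δ G u)       ≡⟨ cong (_* recip (Δ G u)) (ℕ→ℚ-* 2 (Z u)) ⟩
    ℕ→ℚ 2 * ℕ→ℚ (Z u) * recip (Δ G u)     ≡⟨ ℚP.*-assoc (ℕ→ℚ 2) (ℕ→ℚ (Z u)) (recip (Δ G u)) ⟩
    ℕ→ℚ 2 * Z/Δ u                         ∎
    where
    open ℚP.≤-Reasoning
    Δ′ : ℚ
    Δ′ = ℕ→ℚ (Δ G u)

  Δ*𝟙bad≤8y+2Z/Δ : ∀ u → ℕ→ℚ (Δ G u) * 𝟙 (bad G u) ≤ ℕ→ℚ 8 * yℚ u + ℕ→ℚ 2 * Z/Δ u
  Δ*𝟙bad≤8y+2Z/Δ u = by-badness (bad G u) refl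
    where
    Δ′ bound : ℚ
    Δ′    = ℕ→ℚ (Δ G u)
    bound = ℕ→ℚ 8 * yℚ u + ℕ→ℚ 2 * Z/Δ u
    0≤8y : 0ℚ ≤ ℕ→ℚ 8 * yℚ u
    0≤8y = 0≤* (0≤ℕ→ℚ 8) (0≤ℕ→ℚ (y G c u))
    0≤2Z/Δ : 0ℚ ≤ ℕ→ℚ 2 * Z/Δ u
    0≤2Z/Δ = 0≤* (0≤ℕ→ℚ 2) (0≤Z/Δ u)
    by-lightness : ∀ l → light u ≡ l → bad G u ≡ true → Δ′ ≤ bound
    by-lightness true  u-light u-bad = ℚP.≤-trans (Δ≤2Z/Δ u u-bad u-light) (p≤q+p (ℕ→ℚ 2 * Z/Δ u) 0≤8y)
    by-lightness false u-heavy _     = ℚP.≤-trans (ℚP.≤-trans (ℕ→ℚ-mono-≤ (heavy⇒Δ≤8y u u-heavy))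
      (ℚP.≤-reflexive (ℕ→ℚ-* 8 (y G c u)))) (p≤p+q (ℕ→ℚ 8 * yℚ u) 0≤2Z/Δ)
    by-badness : ∀ b → bad G u ≡ b → Δ′ * 𝟙 b ≤ bound
    by-badness true  u-bad = subst (_≤ bound) (sym (ℚP.*-identityʳ Δ′)) (by-lightness (light u) refl u-bad)
    by-badness false _     = subst (_≤ bound) (sym (ℚP.*-zeroʳ Δ′)) (ℚP.+-mono-≤ 0≤8y 0≤2Z/Δ)

  Δ*charge≤9y+2Z/Δ : ∀ u → ℕ→ℚ (Δ G u) * charge u ≤ ℕ→ℚ 9 * yℚ u + ℕ→ℚ 2 * Z/Δ u
  Δ*charge≤9y+2Z/Δ u = begin
    Δ′ * charge u                                   ≡⟨ ℚP.*-distribˡ-+ Δ′ (𝟙 (bad G u)) (y/Δ u) ⟩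
    Δ′ * 𝟙 (bad G u) + Δ′ * y/Δ u                   ≡⟨ cong (_+_ (Δ′ * 𝟙 (bad G u))) Δ*y/Δ≡y ⟩
    Δ′ * 𝟙 (bad G u) + yℚ u                         ≤⟨ ℚP.+-monoˡ-≤ (yℚ u) (Δ*𝟙bad≤8y+2Z/Δ u) ⟩
    ℕ→ℚ 8 * yℚ u + ℕ→ℚ 2 * Z/Δ u + yℚ u             ≡⟨ collect (yℚ u) (Z/Δ u) ⟩
    ℕ→ℚ 9 * yℚ u + ℕ→ℚ 2 * Z/Δ u                    ∎
    where
    open ℚP.≤-Reasoning
    open +-*-Solver using (solve; _:+_; _:*_; _:=_; con)
    Δ′ : ℚ
    Δ′ = ℕ→ℚ (Δ G u)
    Δ*y/Δ≡y : Δ′ * y/Δ u ≡ yℚ u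
    Δ*y/Δ≡y = begin-equality
      Δ′ * (yℚ u * recip (Δ G u))   ≡⟨ ℚP.*-comm Δ′ (y/Δ u) ⟩
      yℚ u * recip (Δ G u) * Δ′     ≡⟨ ℚP.*-assoc (yℚ u) (recip (Δ G u)) Δ′ ⟩
      yℚ u * (recip (Δ G u) * Δ′)   ≡⟨ cong (yℚ u *_) (trans (ℚP.*-comm (recip (Δ G u)) Δ′) (ℕ→ℚ*recip≡1 (Δ≥1 u))) ⟩
      yℚ u * 1ℚ                     ≡⟨ ℚP.*-identityʳ (yℚ u) ⟩
      yℚ u                          ∎
    collect : ∀ y z → ℕ→ℚ 8 * y + ℕ→ℚ 2 * z + y ≡ ℕ→ℚ 9 * y + ℕ→ℚ 2 * z
    collect = solve 2 (λ y z → con (ℕ→ℚ 8) :* y :+ con (ℕ→ℚ 2) :* z :+ y := con (ℕ→ℚ 9) :* y :+ con (ℕ→ℚ 2) :* z) refl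

  ∑Δcharge≤9cost+2∑Z/Δ : ∑Δcharge ≤ ℕ→ℚ 9 * ℕ→ℚ (cost G c) + ℕ→ℚ 2 * ∑V Z/Δ
  ∑Δcharge≤9cost+2∑Z/Δ = begin
    ∑Δcharge                                                ≤⟨ ∑-mono-≤ V Δ*charge≤9y+2Z/Δ ⟩
    ∑V (λ u → ℕ→ℚ 9 * yℚ u + ℕ→ℚ 2 * Z/Δ u)                 ≡⟨ ∑-distrib-+ V (λ u → ℕ→ℚ 9 * yℚ u) (λ u → ℕ→ℚ 2 * Z/Δ u) ⟩
    ∑V (λ u → ℕ→ℚ 9 * yℚ u) + ∑V (λ u → ℕ→ℚ 2 * Z/Δ u)      ≡⟨ cong₂ _+_ (∑-distribˡ-* V yℚ (ℕ→ℚ 9)) (∑-distribˡ-* V Z/Δ (ℕ→ℚ 2)) ⟩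
    ℕ→ℚ 9 * ∑V yℚ + ℕ→ℚ 2 * ∑V Z/Δ                         ≡⟨ cong (λ t → ℕ→ℚ 9 * t + ℕ→ℚ 2 * ∑V Z/Δ) cost≡∑y ⟨
    ℕ→ℚ 9 * ℕ→ℚ (cost G c) + ℕ→ℚ 2 * ∑V Z/Δ                ∎
    where open ℚP.≤-Reasoning

  -- Counting witnesses

  witness-parts : ∀ {u v w} → witness u v w ≡ true →
                  light u ≡ true × same u v ≡ false × G v w ≡ true × same u w ≡ true
  witness-parts {u} {v} {w} uvw =
    ∧-conicalˡ (light u) _ uvw , not-true (∧-conicalʳ (negClose u v) (not (same u v)) uv-sep) ,
    ∧-conicalʳ (G u w) (G v w) (∧-conicalˡ (G u w ∧ G v w) (same u w) uvw-common) ,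
    ∧-conicalʳ (G u w ∧ G v w) (same u w) uvw-common
    where
    uv-sep : separatedClose u v ≡ true
    uv-sep = ∧-conicalˡ (separatedClose u v) _ (∧-conicalʳ (light u) _ uvw)
    uvw-common : commonInCluster u v w ≡ true
    uvw-common = ∧-conicalʳ (separatedClose u v) _ (∧-conicalʳ (light u) _ uvw)
    not-true : ∀ {b} → not b ≡ true → b ≡ false
    not-true {false} _ = refl

  witness⇒disagree : ∀ {u v w} → witness u v w ≡ true → disagree v w ≡ true
  witness⇒disagree {u} {v} {w} uvw with witness-parts uvw
  ... | _ , uv-apart , Gvw , uw-same = disagree-cut Gvw vw-apart
    where
    vw-apart : same v w ≡ false
    vw-apart = begin
      same v w ≡⟨ same-sym v w ⟩
      same w v ≡⟨ same-trans (trans (same-sym w u) uw-same) v ⟩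
      same u v ≡⟨ uv-apart ⟩
      false    ∎
      where open ≡-Reasoning

  clusterSize : Fin n → ℕ
  clusterSize w = count (λ x → same x w)

  8clusterSize≤9Δ : ∀ u w → light u ≡ true → same u w ≡ true → 8 ℕ.* clusterSize w ℕ.≤ 9 ℕ.* Δ G u
  8clusterSize≤9Δ u w u-light uw-same = begin
    8 ℕ.* clusterSize w               ≡⟨ cong (8 ℕ.*_) (countIn-cong V (λ x → trans (same-sym x w) (sym (same-trans uw-same x)))) ⟩
    8 ℕ.* count (same u)              ≤⟨ ℕP.*-monoʳ-≤ 8 (countIn-≤-+ V (λ x → cover (G u x) (same u x))) ⟩
    8 ℕ.* (Δ G u ℕ.+ y G c u)         ≡⟨ ℕP.*-distribˡ-+ 8 (Δ G u) (y G c u) ⟩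
    8 ℕ.* Δ G u ℕ.+ 8 ℕ.* y G c u     ≤⟨ ℕP.+-monoʳ-≤ (8 ℕ.* Δ G u) (light⇒8y≤Δ u u-light) ⟩
    8 ℕ.* Δ G u ℕ.+ Δ G u             ≡⟨ ℕP.+-comm (8 ℕ.* Δ G u) (Δ G u) ⟩
    9 ℕ.* Δ G u                       ∎
    where
    open ℕP.≤-Reasoning
    cover : ∀ g s → s ≡ true → g ∨ ((g ∧ not s) ∨ (not g ∧ s)) ≡ true
    cover true  s     _ = refl
    cover false true  _ = refl

  1≤clusterSize : ∀ w → 1 ℕ.≤ clusterSize w
  1≤clusterSize w = countIn-∈ (∈-allFin w) (same-refl w)

  witness-term≤ : ∀ u v w → 𝟙 (witness u v w) * (ℕ→ℚ 8 * recip (Δ G u)) ≤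
                  𝟙 (disagree v w) * (𝟙 (same u w) * (ℕ→ℚ 9 * recip (clusterSize w)))
  witness-term≤ u v w = by-witness (witness u v w) refl
    where
    9/∣C∣ : ℚ
    9/∣C∣ = ℕ→ℚ 9 * recip (clusterSize w)
    0≤9/∣C∣ : 0ℚ ≤ 9/∣C∣
    0≤9/∣C∣ = 0≤* (0≤ℕ→ℚ 9) (0≤recip (clusterSize w))
    by-witness : ∀ b → witness u v w ≡ b → 𝟙 b * (ℕ→ℚ 8 * recip (Δ G u)) ≤ 𝟙 (disagree v w) * (𝟙 (same u w) * 9/∣C∣)
    by-witness true uvw with witness-parts uvw
    ... | u-light , _ , _ , uw-same = subst₂ _≤_ (sym (ℚP.*-identityˡ _))
      (sym (trans (cong₂ (λ a b → 𝟙 a * (𝟙 b * 9/∣C∣)) (witness⇒disagree uvw) uw-same)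
                  (trans (ℚP.*-identityˡ _) (ℚP.*-identityˡ _))))
      (ℕ→ℚ*recip-cross-≤ 8 9 (1≤clusterSize w) (Δ≥1 u) (8clusterSize≤9Δ u w u-light uw-same))
    by-witness false _ = subst (_≤ 𝟙 (disagree v w) * (𝟙 (same u w) * 9/∣C∣)) (sym (ℚP.*-zeroˡ (ℕ→ℚ 8 * recip (Δ G u))))
      (0≤* (0≤𝟙 (disagree v w)) (0≤* (0≤𝟙 (same u w)) 0≤9/∣C∣))

  8∑witness/Δ≤9𝟙disagree : ∀ v w → ℕ→ℚ 8 * ∑V (λ u → 𝟙 (witness u v w) * recip (Δ G u)) ≤ ℕ→ℚ 9 * 𝟙 (disagree v w)
  8∑witness/Δ≤9𝟙disagree v w = begin
    ℕ→ℚ 8 * ∑V (λ u → 𝟙 (witness u v w) * recip (Δ G u))    ≡⟨ ∑-distribˡ-* V (λ u → 𝟙 (witness u v w) * recip (Δ G u)) (ℕ→ℚ 8) ⟨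
    ∑V (λ u → ℕ→ℚ 8 * (𝟙 (witness u v w) * recip (Δ G u)))  ≡⟨ ∑-cong V (λ u → swap (ℕ→ℚ 8) (𝟙 (witness u v w)) (recip (Δ G u))) ⟩
    ∑V (λ u → 𝟙 (witness u v w) * (ℕ→ℚ 8 * recip (Δ G u)))  ≤⟨ ∑-mono-≤ V (λ u → witness-term≤ u v w) ⟩
    ∑V (λ u → 𝟙 dis * (𝟙 (same u w) * 9/∣C∣))               ≡⟨ ∑-distribˡ-* V (λ u → 𝟙 (same u w) * 9/∣C∣) (𝟙 dis) ⟩
    𝟙 dis * ∑V (λ u → 𝟙 (same u w) * 9/∣C∣)                 ≡⟨ cong (𝟙 dis *_) (∑-distribʳ-* V (λ u → 𝟙 (same u w)) 9/∣C∣) ⟩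
    𝟙 dis * (∑V (λ u → 𝟙 (same u w)) * 9/∣C∣)               ≡⟨ cong (λ t → 𝟙 dis * (t * 9/∣C∣)) (ℕ→ℚ-countIn V (λ u → same u w)) ⟨
    𝟙 dis * (ℕ→ℚ (clusterSize w) * 9/∣C∣)                   ≡⟨ cong (𝟙 dis *_) (swap (ℕ→ℚ (clusterSize w)) (ℕ→ℚ 9) (recip (clusterSize w))) ⟩
    𝟙 dis * (ℕ→ℚ 9 * (ℕ→ℚ (clusterSize w) * recip (clusterSize w))) ≡⟨ cong (λ t → 𝟙 dis * (ℕ→ℚ 9 * t)) (ℕ→ℚ*recip≡1 (1≤clusterSize w)) ⟩
    𝟙 dis * (ℕ→ℚ 9 * 1ℚ)                                    ≡⟨ trans (cong (𝟙 dis *_) (ℚP.*-identityʳ (ℕ→ℚ 9))) (ℚP.*-comm (𝟙 dis) (ℕ→ℚ 9)) ⟩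
    ℕ→ℚ 9 * 𝟙 dis                                           ∎
    where
    open ℚP.≤-Reasoning
    open +-*-Solver using (solve; _:*_; _:=_)
    dis : Bool
    dis = disagree v w
    9/∣C∣ : ℚ
    9/∣C∣ = ℕ→ℚ 9 * recip (clusterSize w)
    swap : ∀ a b r → a * (b * r) ≡ b * (a * r)
    swap = solve 3 (λ a b r → a :* (b :* r) := b :* (a :* r)) refl

  Z/Δ≡∑∑witness/Δ : ∀ u → Z/Δ u ≡ ∑V (λ v → ∑V (λ w → 𝟙 (witness u v w) * recip (Δ G u)))
  Z/Δ≡∑∑witness/Δ u = begin
    ℕ→ℚ (Z u) * recip (Δ G u)                                     ≡⟨ cong (_* recip (Δ G u)) ℕ→ℚ-Z ⟩
    ∑V (λ v → ∑V (λ w → 𝟙 (witness u v w))) * recip (Δ G u)      ≡⟨ ∑-distribʳ-* V (λ v → ∑V (λ w → 𝟙 (witness u v w))) (recip (Δ G u)) ⟨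
    ∑V (λ v → ∑V (λ w → 𝟙 (witness u v w)) * recip (Δ G u))      ≡⟨ ∑-cong V (λ v → ∑-distribʳ-* V (λ w → 𝟙 (witness u v w)) (recip (Δ G u))) ⟨
    ∑V (λ v → ∑V (λ w → 𝟙 (witness u v w) * recip (Δ G u)))      ∎
    where
    open ≡-Reasoning
    ℕ→ℚ-Z : ℕ→ℚ (Z u) ≡ ∑V (λ v → ∑V (λ w → 𝟙 (witness u v w)))
    ℕ→ℚ-Z = trans (ℕ→ℚ-sumℕ V (λ v → count (witness u v))) (∑-cong V (λ v → ℕ→ℚ-countIn V (witness u v)))

  8∑Z/Δ≤9cost : ℕ→ℚ 8 * ∑V Z/Δ ≤ ℕ→ℚ 9 * ℕ→ℚ (cost G c)
  8∑Z/Δ≤9cost = begin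
    ℕ→ℚ 8 * ∑V Z/Δ                                         ≡⟨ cong (ℕ→ℚ 8 *_) (∑-cong V Z/Δ≡∑∑witness/Δ) ⟩
    ℕ→ℚ 8 * ∑V (λ u → ∑V (λ v → ∑V (λ w → F u v w)))      ≡⟨ cong (ℕ→ℚ 8 *_) (trans (∑-comm V V (λ u v → ∑V (F u v))) (∑-cong V (λ v → ∑-comm V V (λ u w → F u v w)))) ⟩
    ℕ→ℚ 8 * ∑V (λ v → ∑V (λ w → ∑V (λ u → F u v w)))      ≡⟨ trans (∑-cong V (λ v → ∑-distribˡ-* V (λ w → ∑V (λ u → F u v w)) (ℕ→ℚ 8))) (∑-distribˡ-* V (λ v → ∑V (λ w → ∑V (λ u → F u v w))) (ℕ→ℚ 8)) ⟨
    ∑V (λ v → ∑V (λ w → ℕ→ℚ 8 * ∑V (λ u → F u v w)))      ≤⟨ ∑-mono-≤ V (λ v → ∑-mono-≤ V (8∑witness/Δ≤9𝟙disagree v)) ⟩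
    ∑V (λ v → ∑V (λ w → ℕ→ℚ 9 * 𝟙 (disagree v w)))       ≡⟨ ∑-cong V (λ v → ∑-distribˡ-* V (λ w → 𝟙 (disagree v w)) (ℕ→ℚ 9)) ⟩
    ∑V (λ v → ℕ→ℚ 9 * ∑V (λ w → 𝟙 (disagree v w)))       ≡⟨ ∑-distribˡ-* V (λ v → ∑V (λ w → 𝟙 (disagree v w))) (ℕ→ℚ 9) ⟩
    ℕ→ℚ 9 * ∑V (λ v → ∑V (λ w → 𝟙 (disagree v w)))       ≡⟨ cong (ℕ→ℚ 9 *_) ∑∑-disagree ⟩
    ℕ→ℚ 9 * ℕ→ℚ (cost G c)                                ∎
    where
    open ℚP.≤-Reasoning
    F : Fin n → Fin n → Fin n → ℚ
    F u v w = 𝟙 (witness u v w) * recip (Δ G u)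

lemma8 : (n : ℕ) (G : SignedGraph n)
         → (∀ u v → G u v ≡ G v u)
         → (∀ u → G u u ≡ true)
         → (C : Clustering G)
         → fPositiveSum G ≤ (+ 34 / 1) * ℕ→ℚ (cost G C)
lemma8 n G G-sym G-refl C = begin
  fPositiveSum G                          ≤⟨ fPositiveSum≤∑Δcharge+∑Δcharge+cost ⟩
  ∑Δcharge + ∑Δcharge + cost′             ≤⟨ ℚP.+-monoˡ-≤ cost′ (ℚP.+-mono-≤ ∑Δcharge≤9cost+2∑Z/Δ ∑Δcharge≤9cost+2∑Z/Δ) ⟩
  9c+2z + 9c+2z + cost′                   ≡⟨ regroup₁ cost′ (∑V Z/Δ) ⟩
  ℕ→ℚ 19 * cost′ + ½ * (ℕ→ℚ 8 * ∑V Z/Δ)   ≤⟨ ℚP.+-monoʳ-≤ (ℕ→ℚ 19 * cost′) (*-monoˡ-≤-nonNeg′ ½ (ℚP.≤ᵇ⇒≤ _) 8∑Z/Δ≤9cost) ⟩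
  ℕ→ℚ 19 * cost′ + ½ * (ℕ→ℚ 9 * cost′)    ≡⟨ regroup₂ cost′ ⟩
  (+ 47 / 2) * cost′                      ≤⟨ *-monoʳ-≤-nonNeg′ cost′ (0≤ℕ→ℚ (cost G C)) (ℚP.≤ᵇ⇒≤ {+ 47 / 2} {+ 34 / 1} _) ⟩
  (+ 34 / 1) * cost′                      ∎
  where
  open Charging G G-sym G-refl C
  open ℚP.≤-Reasoning
  open +-*-Solver using (solve; _:+_; _:*_; _:=_; con)
  cost′ 9c+2z ½ : ℚ
  cost′ = ℕ→ℚ (cost G C)
  9c+2z = ℕ→ℚ 9 * cost′ + ℕ→ℚ 2 * ∑V Z/Δ
  ½ = + 1 / 2
  regroup₁ : ∀ c z → (ℕ→ℚ 9 * c + ℕ→ℚ 2 * z) + (ℕ→ℚ 9 * c + ℕ→ℚ 2 * z) + c ≡ ℕ→ℚ 19 * c + ½ * (ℕ→ℚ 8 * z)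
  regroup₁ = solve 2 (λ c z → (con (ℕ→ℚ 9) :* c :+ con (ℕ→ℚ 2) :* z) :+ (con (ℕ→ℚ 9) :* c :+ con (ℕ→ℚ 2) :* z) :+ c
                              := con (ℕ→ℚ 19) :* c :+ con ½ :* (con (ℕ→ℚ 8) :* z)) refl
  regroup₂ : ∀ c → ℕ→ℚ 19 * c + ½ * (ℕ→ℚ 9 * c) ≡ (+ 47 / 2) * c
  regroup₂ = solve 1 (λ c → con (ℕ→ℚ 19) :* c :+ con ½ :* (con (ℕ→ℚ 9) :* c) := con (+ 47 / 2) :* c) refl
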